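{- Let $G$ be a simple $n$-vertex graph of maximum degree at most $\Delta$ that is properly $(\Delta+C)$-edge colored except for one uncolored edge $(u,v)$, and let $b$ be a positive integer with $b\le C$. Let $T$ be the shift-tree of $G$ with respect to $(u,v)$, extended level by level until either (1) a useful shiftable path is found (some node $x$ with parent $p$ is such that after shifting along the tree path from $(u,v)$ to $(p,x)$, the edge $(p,x)$ can be colored by a color available at both $p$ and $x$), or (2) some vertex of $G$ has $b$ inactive copies in $T$. Let $\beta=\frac{C+1}{b}$ and $H=\lfloor\log_\beta n\rfloor$. Then $\mathrm{depth}(T)\le H+1$.
   Context: For a vertex $w$, $A(w)$ is the set of colors not used on edges incident to $w$. Shifting colors along a chain of edges $[e_1,\dots,e_k]$ (consecutive edges sharing one endpoint) gives each $e_i$ the current color of $e_{i+1}$ and leaves $e_k$ uncolored. Shift-tree $T$ w.r.t. $(u,v)$: root $v$; $u$ is regarded as parent of $v$ but not in $T$; leaves are active or inactive, the root active. Level $i+1$ from level $i$: inactive leaves remain leaves; for an active leaf $x$ with parent $p$, $y$ is a child of $x$ iff $(x,y)\in G$ and $\mathrm{color}(x,y)\in A'(p)$, where $A'(p)$ is the set of colors available at $p$ after shifting along the tree path from $(u,v)$ to $(p,x)$ so that $(p,x)$ becomes uncolored; a new child $y$ is active if it is the first occurrence of the vertex $y$ in $T$, otherwise inactive. Copies of a vertex are the nodes of $T$ corresponding to it. The depth of $T$ is the maximum number of edges on a root-to-node path. -}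

module Defs where

open import Data.Nat using (ℕ; zero; suc; _+_; _*_; _^_; _≤_; _<_)
open import Data.Fin using (Fin; _≟_)
open import Data.List using (List; []; _∷_; _++_; length; filterᵇ; allFin)
open import Data.Bool.ListAction using (any)
open import Data.List.Membership.Propositional using (_∈_)
open import Data.Bool using (Bool; true; false; if_then_else_; not; _∧_; _∨_; T)
open import Data.Maybe using (Maybe; just; nothing)
open import Data.Product using (Σ; _×_; _,_; proj₁; proj₂)
open import Data.Sum using (_⊎_)
open import Data.Empty using (⊥)
open import Relation.Nullary using (¬_; does)
open import Relation.Binary.PropositionalEquality using (_≡_; _≢_)

Graph : ℕ → Set
Graph n = Fin n → Fin n → Bool

-- simple (undirected, loopless; no multi-edges by construction)
SimpleGraph : ∀ {n} → Graph n → Set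
SimpleGraph {n} G = (∀ (a : Fin n) → G a a ≡ false) × (∀ (a b : Fin n) → G a b ≡ G b a)

degree : ∀ {n} → Graph n → Fin n → ℕ
degree {n} G a = length (filterᵇ (G a) (allFin n))

MaxDegreeAtMost : ∀ {n} → Graph n → ℕ → Set
MaxDegreeAtMost G Δ = ∀ a → degree G a ≤ Δ

-- partial edge colourings with colours Fin k ("nothing" = uncoloured)
Colouring : ℕ → ℕ → Set
Colouring n k = Fin n → Fin n → Maybe (Fin k)

ProperlyColouredExcept : ∀ {n k} → Graph n → Colouring n k → Fin n → Fin n → Set
ProperlyColouredExcept {n} {k} G col u v =
  (G u v ≡ true) ×
  (col u v ≡ nothing) ×
  (∀ (a b : Fin n) → col a b ≡ col b a) ×
  (∀ (a b : Fin n) → G a b ≡ false → col a b ≡ nothing) ×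
  (∀ (a b : Fin n) → G a b ≡ true → col a b ≡ nothing → (a ≡ u × b ≡ v) ⊎ (a ≡ v × b ≡ u)) ×
  (∀ (a b b' : Fin n) (c : Fin k) → col a b ≡ just c → col a b' ≡ just c → b ≡ b')

_==_ : ∀ {n} → Fin n → Fin n → Bool
a == b = does (a ≟ b)

sameEdge : ∀ {n} → Fin n → Fin n → Fin n → Fin n → Bool
sameEdge a b s t = ((a == s) ∧ (b == t)) ∨ ((a == t) ∧ (b == s))

hasColour : ∀ {k} → Maybe (Fin k) → Fin k → Bool
hasColour nothing  c = false
hasColour (just d) c = d == c

available : ∀ {n k} → Colouring n k → Fin n → Fin k → Bool
available {n} col w c = not (any (λ z → hasColour (col w z) c) (allFin n))

-- A chain is given by the REVERSED list of its
-- vertices  x ∷ p ∷ ... ∷ v ∷ u ∷ [] , i.e. the chain of edges is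
-- e₁ = (u,v), ..., e_m = (p,x).  Each eᵢ gets the (original) colour of
-- e_{i+1} and e_m becomes uncoloured; other edges keep their colours.

shiftGo : ∀ {n k} → Colouring n k → Fin n → Fin n → List (Fin n) → Colouring n k
shiftGo col a b []         s t = col s t
shiftGo col a b (c ∷ rest) s t =
  if sameEdge b c s t then col a b else shiftGo col b c rest s t

shiftRev : ∀ {n k} → Colouring n k → List (Fin n) → Colouring n k
shiftRev col (a ∷ b ∷ rest) s t =
  if sameEdge a b s t then nothing else shiftGo col a b rest s t
shiftRev col _ s t = col s t

-- A node is (reversed root path, active flag): the path
-- x ∷ p ∷ ... ∷ v ∷ u ∷ [] lists the node's vertex x, its parent p, ...,
-- the root v and finally u (the parent of the root, not itself in T).

Node : ℕ → Set
Node n = List (Fin n) × Bool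

module ShiftTree {n k : ℕ} (G : Graph n) (col : Colouring n k) (u v : Fin n) where

  colourIn : Maybe (Fin k) → (Fin k → Bool) → Bool
  colourIn nothing  P = false
  colourIn (just c) P = P c

  -- children vertices y of an (active) node with path x ∷ p ∷ _ :
  -- (x,y) ∈ G and the (current, i.e. after the shift) colour of (x,y)
  -- lies in A'(p).  Listed in increasing vertex order.
  childVertices : List (Fin n) → List (Fin n)
  childVertices (x ∷ p ∷ rest) =
    let col' = shiftRev col (x ∷ p ∷ rest) in
    filterᵇ (λ y → G x y ∧ colourIn (col' x y) (available col' p)) (allFin n)
  childVertices _ = []

  -- attach children; a child is active iff its vertex has not occurred in T
  placeChildren : List (Fin n) → List (Fin n) → List (Fin n) → List (Node n) × List (Fin n)
  placeChildren path []       seen = [] , seen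
  placeChildren path (y ∷ ys) seen =
    let r = placeChildren path ys (y ∷ seen) in
    ((y ∷ path) , not (any (y ==_) seen)) ∷ proj₁ r , proj₂ r

  nextLevel : List (Node n) → List (Fin n) → List (Node n) × List (Fin n)
  nextLevel []                     seen = [] , seen
  nextLevel ((path , false) ∷ rest) seen = nextLevel rest seen
  nextLevel ((path , true)  ∷ rest) seen =
    let r₁ = placeChildren path (childVertices path) seen
        r₂ = nextLevel rest (proj₂ r₁)
    in proj₁ r₁ ++ proj₁ r₂ , proj₂ r₂

  root : Node n
  root = (v ∷ u ∷ []) , true

  -- state after building levels 0..d (without stopping):
  -- (all nodes of levels 0..d , nodes of level d , vertices occurring so far)
  grow : ℕ → List (Node n) × List (Node n) × List (Fin n)
  grow zero    = (root ∷ []) , (root ∷ []) , (v ∷ [])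
  grow (suc d) with grow d
  ... | all , cur , seen with nextLevel cur seen
  ...   | new , seen' = (all ++ new) , new , seen'

  nodesUpTo : ℕ → List (Node n)
  nodesUpTo d = proj₁ (grow d)

  level : ℕ → List (Node n)
  level d = proj₁ (proj₂ (grow d))

  UsefulNode : Node n → Set
  UsefulNode ((x ∷ p ∷ rest) , _) =
    let col' = shiftRev col (x ∷ p ∷ rest) in
    Σ (Fin k) λ c → T (available col' p c ∧ available col' x c)
  UsefulNode _ = ⊥

  HasUseful : List (Node n) → Set
  HasUseful ns = Σ (Node n) λ nd → nd ∈ ns × UsefulNode nd

  isInactiveCopyOf : Fin n → Node n → Bool
  isInactiveCopyOf w ((x ∷ _) , act) = (x == w) ∧ not act
  isInactiveCopyOf w ([] , act)      = false

  HasBInactive : ℕ → List (Node n) → Set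
  HasBInactive b ns = Σ (Fin n) λ w → b ≤ length (filterᵇ (isInactiveCopyOf w) ns)

  StopsAt : ℕ → ℕ → Set
  StopsAt b d = HasUseful (nodesUpTo d) ⊎ HasBInactive b (nodesUpTo d)

  -- depth(T) ≤ h, where T consists of levels 0..K, K the first level
  -- after which the construction stops (all levels if it never stops):
  -- every non-empty level d of T (i.e. no stop before d) has d ≤ h.
  DepthAtMost : ℕ → ℕ → Set
  DepthAtMost b h = ∀ d → (∀ j → j < d → ¬ StopsAt b j) → level d ≢ [] → d ≤ h

-- H = ⌊log_β n⌋ with β = (C+1)/b, i.e. β^H ≤ n < β^(H+1), cleared of
-- denominators.
IsFloorLog : (C b n H : ℕ) → Set
IsFloorLog C b n H = ((suc C) ^ H ≤ n * b ^ H) × (n * b ^ (suc H) < (suc C) ^ (suc H))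

{-# OPTIONS --safe #-}
-- An active node x with parent p that is not useful has at least C + 1 children: after the
-- shift, (p,x) is uncoloured, so at most Δ - 1 colours are missing at p and at least C + 1
-- colours are free at p; none of them is free at x, so each colours an edge (x,y), and y is a child.
-- Every node is a copy of a vertex with an active copy, so while no vertex has b inactive copies,
-- no vertex has more than b copies. Let a_d be the number of active nodes in levels ≤ d; they have
-- distinct vertices, so a_d ≤ n. If the construction has not stopped, levels ≤ d + 1 contain at
-- least 1 + (C + 1) a_d and at most b a_{d+1} nodes, whence β^d ≤ a_d. For d = H + 1 this
-- contradicts n < β^(H+1), so the construction stops by level H + 1.

module Submission where

open import Defs
open import Algebra.Properties.CommutativeSemigroup
  using (x∙yz≈y∙xz; x∙yz≈yx∙z)
open import Data.Bool using (Bool; true; false; T; not; _∧_)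
open import Data.Bool.Properties using (T-∧; T-∨; T-≡)
open import Data.Bool.ListAction using (any)
open import Data.Empty using (⊥)
open import Data.Fin using (Fin; _≟_)
open import Data.List using (List; []; _∷_; [_]; _++_; length; filterᵇ; mapMaybe; allFin)
open import Data.List.Properties using (length-++; length-mapMaybe; mapMaybe-++; length-tabulate)
open import Data.List.Membership.Propositional using (_∈_; _∉_)
open import Data.List.Membership.Propositional.Properties
  using (∈-∃++; ∈-++⁺ˡ; ∈-++⁺ʳ; ∈-++⁻; ∈-filter⁺; ∈-filter⁻; ∈-allFin)
open import Data.List.Relation.Binary.Subset.Propositional using (_⊆_)
open import Data.List.Relation.Binary.Permutation.Propositional.Properties
  using (shift; ↭-length; ∈-resp-↭)
import Data.List.Relation.Binary.Sublist.Propositional.Properties as Sublist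
open import Data.List.Relation.Unary.All as All using (All; []; _∷_)
import Data.List.Relation.Unary.All.Properties as All
open import Data.List.Relation.Unary.Any as Any using (here; there)
open import Data.List.Relation.Unary.Any.Properties using (any⁺; any⁻)
open import Data.List.Relation.Unary.Linked using (Linked; [-]; _∷_)
open import Data.List.Relation.Unary.Unique.Propositional using (Unique; []; _∷_)
open import Data.List.Relation.Unary.Unique.Propositional.Properties
  using (allFin⁺) renaming (++⁺ to Unique-++⁺)
open import Data.Maybe using (Maybe; just; nothing)
open import Data.Nat using (ℕ; zero; suc; _+_; _*_; _^_; _≤_; _<_; z≤n; s≤s)
open import Data.Nat.Properties hiding (_≟_)
open import Data.Product using (∃-syntax; _×_; _,_; proj₁; proj₂; uncurry)
import Data.Product as Product
open import Data.Sum using (_⊎_; inj₁; inj₂; [_,_]′)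
import Data.Sum as Sum
open import Function using (_∘_; id)
open import Function.Bundles using (Equivalence)
open import Relation.Binary.Definitions using (DecidableEquality)
open import Relation.Binary.PropositionalEquality using (_≡_; refl; sym; trans; cong; subst; module ≡-Reasoning)
open import Relation.Nullary using (¬_; Dec; does; yes; no; contradiction)
open import Relation.Nullary.Decidable using (T?; dec-true)

open Equivalence using (to; from)

private variable
  A B : Set

T-does⇒ : {P : Set} (P? : Dec P) → T (does P?) → P
T-does⇒ (yes p) _ = p

⇒T-does : {P : Set} (P? : Dec P) → P → T (does P?)
⇒T-does P? p = from T-≡ (dec-true P? p)

T-not-does⇒ : {P : Set} (P? : Dec P) → T (not (does P?)) → ¬ P
T-not-does⇒ (no ¬p) _ = ¬p

¬T-not⇒T : {b : Bool} → ¬ T (not b) → T b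
¬T-not⇒T {false} ¬t = ¬t _
¬T-not⇒T {true}  _  = _

unique⊆⇒length≤ : {xs ys : List A} → Unique xs → xs ⊆ ys → length xs ≤ length ys
unique⊆⇒length≤ {xs = []} [] _ = z≤n
unique⊆⇒length≤ {xs = x ∷ xs} (x∉xs ∷ xs!) x∷xs⊆ys
  with ys₁ , ys₂ , refl ← ∈-∃++ (x∷xs⊆ys (here refl)) = begin
    suc (length xs)            ≤⟨ s≤s (unique⊆⇒length≤ xs! xs⊆ys₁ys₂) ⟩
    suc (length (ys₁ ++ ys₂))  ≡⟨ ↭-length (shift x ys₁ ys₂) ⟨
    length (ys₁ ++ x ∷ ys₂)    ∎
  where
  open ≤-Reasoning
  xs⊆ys₁ys₂ : xs ⊆ ys₁ ++ ys₂
  xs⊆ys₁ys₂ y∈xs with ∈-resp-↭ (shift x ys₁ ys₂) (x∷xs⊆ys (there y∈xs))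
  ... | here refl  = contradiction refl (All.lookup x∉xs y∈xs)
  ... | there y∈ys = y∈ys

∈-mapMaybe⁺ : {f : A → Maybe B} {x : A} {y : B} {xs : List A} →
              x ∈ xs → f x ≡ just y → y ∈ mapMaybe f xs
∈-mapMaybe⁺ {f = f} {xs = x ∷ xs} (here refl) fx≡y rewrite fx≡y = here refl
∈-mapMaybe⁺ {f = f} {xs = x′ ∷ xs} (there x∈xs) fx≡y with f x′
... | nothing = ∈-mapMaybe⁺ x∈xs fx≡y
... | just _  = there (∈-mapMaybe⁺ x∈xs fx≡y)

length-mapMaybe-< : {f : A → Maybe B} {x : A} {xs : List A} →
                    x ∈ xs → f x ≡ nothing → length (mapMaybe f xs) < length xs
length-mapMaybe-< {f = f} {xs = x ∷ xs} (here refl) fx≡nothing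
  rewrite fx≡nothing = s≤s (length-mapMaybe f xs)
length-mapMaybe-< {f = f} {xs = x′ ∷ xs} (there x∈xs) fx≡nothing with f x′
... | nothing = m<n⇒m<1+n (length-mapMaybe-< x∈xs fx≡nothing)
... | just _  = s≤s (length-mapMaybe-< x∈xs fx≡nothing)

length-filterᵇ-split : (p : A → Bool) (xs : List A) →
                       length xs ≡ length (filterᵇ p xs) + length (filterᵇ (not ∘ p) xs)
length-filterᵇ-split p [] = refl
length-filterᵇ-split p (x ∷ xs) with p x
... | true  = cong suc (length-filterᵇ-split p xs)
... | false = trans (cong suc (length-filterᵇ-split p xs)) (sym (+-suc _ _))

geometric-growth : ∀ {K b} (f : ℕ → ℕ) D → 1 ≤ f 0 →
                   (∀ d → d < D → K * f d ≤ b * f (suc d)) → K ^ D ≤ b ^ D * f D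
geometric-growth f zero 1≤f0 _ = ≤-trans 1≤f0 (≤-reflexive (sym (*-identityˡ (f 0))))
geometric-growth {K} {b} f (suc D) 1≤f0 grows = begin
  K * K ^ D                ≤⟨ *-monoʳ-≤ K (geometric-growth f D 1≤f0 (λ d → grows d ∘ m<n⇒m<1+n)) ⟩
  K * (b ^ D * f D)        ≡⟨ x∙yz≈y∙xz *-commutativeSemigroup K (b ^ D) (f D) ⟩
  b ^ D * (K * f D)        ≤⟨ *-monoʳ-≤ (b ^ D) (grows D ≤-refl) ⟩
  b ^ D * (b * f (suc D))  ≡⟨ x∙yz≈yx∙z *-commutativeSemigroup (b ^ D) b (f (suc D)) ⟩
  b * b ^ D * f (suc D)    ∎
  where open ≤-Reasoning

module _ {A : Set} (_≟ᴬ_ : DecidableEquality A) where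

  multiplicity : A → List A → ℕ
  multiplicity w xs = length (filterᵇ (λ y → does (y ≟ᴬ w)) xs)

  length+length≤*length : ∀ {b} (xs ys : List A) → xs ⊆ ys → (∀ w → multiplicity w xs < b) →
                          length xs + length ys ≤ b * length ys
  length+length≤*length []       []       _       _ = z≤n
  length+length≤*length (x ∷ xs) []       x∷xs⊆[] _ with () ← x∷xs⊆[] (here refl)
  length+length≤*length {b} xs (y ∷ ys) xs⊆y∷ys few = begin
    length xs + suc (length ys)
      ≡⟨ cong (_+ suc (length ys)) (length-filterᵇ-split is-y xs) ⟩
    (multiplicity y xs + length others) + suc (length ys)
      ≡⟨ +-suc _ (length ys) ⟩
    suc ((multiplicity y xs + length others) + length ys)
      ≡⟨ cong suc (+-assoc (multiplicity y xs) _ _) ⟩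
    suc (multiplicity y xs) + (length others + length ys)
      ≤⟨ +-mono-≤ (few y) (length+length≤*length others ys others⊆ys few-others) ⟩
    b + b * length ys
      ≡⟨ *-suc b (length ys) ⟨
    b * suc (length ys) ∎
    where
    open ≤-Reasoning
    is-y : A → Bool
    is-y z = does (z ≟ᴬ y)
    others : List A
    others = filterᵇ (not ∘ is-y) xs
    others⊆ys : others ⊆ ys
    others⊆ys z∈others with z∈xs , z≠y ← ∈-filter⁻ (T? ∘ not ∘ is-y) z∈others
                         with xs⊆y∷ys z∈xs
    ... | here refl  = contradiction refl (T-not-does⇒ (y ≟ᴬ y) z≠y)
    ... | there z∈ys = z∈ys
    few-others : ∀ w → multiplicity w others < b
    few-others w = ≤-<-trans
      (Sublist.length-mono-≤ (Sublist.filter⁺ (T? ∘ _) (T? ∘ _) (λ { refl → id })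
                                               (Sublist.filter-⊆ (T? ∘ not ∘ is-y) xs)))
      (few w)

module _ {n : ℕ} where

  ∈⇒any-== : {y : Fin n} {xs : List (Fin n)} → y ∈ xs → T (any (y ==_) xs)
  ∈⇒any-== {y} = any⁺ _ ∘ Any.map (λ {z} → ⇒T-does (y ≟ z))

  any-==⇒∈ : {y : Fin n} {xs : List (Fin n)} → T (any (y ==_) xs) → y ∈ xs
  any-==⇒∈ {y} = Any.map (λ {z} → T-does⇒ (y ≟ z)) ∘ any⁻ _ _

  sameEdge⇒ : {a b s t : Fin n} → T (sameEdge a b s t) → (a ≡ s × b ≡ t) ⊎ (a ≡ t × b ≡ s)
  sameEdge⇒ {a} {b} {s} {t} =
    Sum.map (Product.map (T-does⇒ (a ≟ s)) (T-does⇒ (b ≟ t)) ∘ to T-∧)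
            (Product.map (T-does⇒ (a ≟ t)) (T-does⇒ (b ≟ s)) ∘ to T-∧)
    ∘ to T-∨

  sameEdge-flip : (a b : Fin n) → T (sameEdge a b b a)
  sameEdge-flip a b =
    from T-∨ (inj₂ (from T-∧ (⇒T-does (a ≟ a) refl , ⇒T-does (b ≟ b) refl)))

  hasColour⇒ : {k : ℕ} {m : Maybe (Fin k)} {c : Fin k} → T (hasColour m c) → m ≡ just c
  hasColour⇒ {m = just d} {c} t = cong just (T-does⇒ (d ≟ c) t)

  unavailable⇒coloured : {k : ℕ} (σ : Colouring n k) (w : Fin n) (c : Fin k) →
                         ¬ T (available σ w c) → ∃[ z ] σ w z ≡ just c
  unavailable⇒coloured σ w c unavailable =
    Product.map₂ hasColour⇒ (Any.satisfied (any⁻ _ (allFin n) (¬T-not⇒T unavailable)))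

module _ {n : ℕ} where

  activeVertex : Node n → Maybe (Fin n)
  activeVertex (_       , false) = nothing
  activeVertex ([]      , true)  = nothing
  activeVertex ((x ∷ _) , true)  = just x

  inactiveVertex : Node n → Maybe (Fin n)
  inactiveVertex (_       , true)  = nothing
  inactiveVertex ([]      , false) = nothing
  inactiveVertex ((x ∷ _) , false) = just x

  activeVertices inactiveVertices : List (Node n) → List (Fin n)
  activeVertices   = mapMaybe activeVertex
  inactiveVertices = mapMaybe inactiveVertex

  VertexIn : List (Fin n) → Node n → Set
  VertexIn S ((x ∷ _) , _) = x ∈ S
  VertexIn S ([] , _)      = ⊥

  VertexIn-mono : {S S′ : List (Fin n)} → S ⊆ S′ → {nd : Node n} →
                  VertexIn S nd → VertexIn S′ nd
  VertexIn-mono S⊆S′ {(_ ∷ _) , _} = S⊆S′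

  activeVertices⊆ : {S : List (Fin n)} {L : List (Node n)} →
                    All (VertexIn S) L → activeVertices L ⊆ S
  activeVertices⊆ {L = ((x ∷ _) , true)  ∷ L} (x∈S ∷ _) (here refl) = x∈S
  activeVertices⊆ {L = ((x ∷ _) , true)  ∷ L} (_ ∷ h)   (there y∈)  = activeVertices⊆ h y∈
  activeVertices⊆ {L = ((x ∷ _) , false) ∷ L} (_ ∷ h)   y∈          = activeVertices⊆ h y∈

  inactiveVertices⊆ : {S : List (Fin n)} {L : List (Node n)} →
                      All (VertexIn S) L → inactiveVertices L ⊆ S
  inactiveVertices⊆ {L = ((x ∷ _) , false) ∷ L} (x∈S ∷ _) (here refl) = x∈S
  inactiveVertices⊆ {L = ((x ∷ _) , false) ∷ L} (_ ∷ h)   (there y∈)  = inactiveVertices⊆ h y∈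
  inactiveVertices⊆ {L = ((x ∷ _) , true)  ∷ L} (_ ∷ h)   y∈          = inactiveVertices⊆ h y∈

  length≤active+inactive : {S : List (Fin n)} {L : List (Node n)} → All (VertexIn S) L →
                           length L ≤ length (activeVertices L) + length (inactiveVertices L)
  length≤active+inactive {L = []} [] = z≤n
  length≤active+inactive {L = ((x ∷ _) , true) ∷ L} (_ ∷ h) = s≤s (length≤active+inactive h)
  length≤active+inactive {L = ((x ∷ _) , false) ∷ L} (_ ∷ h) =
    ≤-trans (s≤s (length≤active+inactive h)) (≤-reflexive (sym (+-suc _ _)))

-- The nodes are appended to a tree whose vertices so far are seen, flagged active exactly at the
-- first occurrence of their vertex; afterwards the vertices of the tree are seen′.
record Marking {n : ℕ} (seen : List (Fin n)) (nodes : List (Node n)) (seen′ : List (Fin n)) : Set where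
  field
    seen⊆seen′        : seen ⊆ seen′
    seen′⊆seen∪active : ∀ {w} → w ∈ seen′ → w ∈ seen ⊎ w ∈ activeVertices nodes
    active∉seen       : ∀ {w} → w ∈ activeVertices nodes → w ∉ seen
    active-unique     : Unique (activeVertices nodes)
    vertices∈seen′    : All (VertexIn seen′) nodes

open Marking

module _ {n : ℕ} where

  marking-[] : {seen : List (Fin n)} → Marking seen [] seen
  marking-[] .seen⊆seen′        = id
  marking-[] .seen′⊆seen∪active = inj₁
  marking-[] .active∉seen ()
  marking-[] .active-unique     = []
  marking-[] .vertices∈seen′    = []

  marking-++ : {s₀ s₁ s₂ : List (Fin n)} {N₁ N₂ : List (Node n)} →
               Marking s₀ N₁ s₁ → Marking s₁ N₂ s₂ → Marking s₀ (N₁ ++ N₂) s₂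
  marking-++ m₁ m₂ .seen⊆seen′ = m₂ .seen⊆seen′ ∘ m₁ .seen⊆seen′
  marking-++ {N₁ = N₁} {N₂} m₁ m₂ .seen′⊆seen∪active w∈s₂
    rewrite mapMaybe-++ activeVertex N₁ N₂ with m₂ .seen′⊆seen∪active w∈s₂
  ... | inj₁ w∈s₁ = Sum.map₂ ∈-++⁺ˡ (m₁ .seen′⊆seen∪active w∈s₁)
  ... | inj₂ w∈a₂ = inj₂ (∈-++⁺ʳ _ w∈a₂)
  marking-++ {N₁ = N₁} {N₂} m₁ m₂ .active∉seen
    rewrite mapMaybe-++ activeVertex N₁ N₂ =
    [ m₁ .active∉seen , (λ w∈a₂ → m₂ .active∉seen w∈a₂ ∘ m₁ .seen⊆seen′) ]′ ∘ ∈-++⁻ _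
  marking-++ {N₁ = N₁} {N₂} m₁ m₂ .active-unique
    rewrite mapMaybe-++ activeVertex N₁ N₂ =
    Unique-++⁺ (m₁ .active-unique) (m₂ .active-unique) λ (w∈a₁ , w∈a₂) →
      m₂ .active∉seen w∈a₂ (activeVertices⊆ (m₁ .vertices∈seen′) w∈a₁)
  marking-++ m₁ m₂ .vertices∈seen′ =
    All.++⁺ (All.map (VertexIn-mono (m₂ .seen⊆seen′)) (m₁ .vertices∈seen′))
            (m₂ .vertices∈seen′)

  marking-child : (path : List (Fin n)) (y : Fin n) (seen : List (Fin n)) →
                  Marking seen [ (y ∷ path , not (any (y ==_) seen)) ] (y ∷ seen)
  marking-child path y seen with any (y ==_) seen in seen-before
  ... | true = record
    { seen⊆seen′        = there
    ; seen′⊆seen∪active = λ { (here refl) → inj₁ (any-==⇒∈ (from T-≡ seen-before))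
                            ; (there w∈)  → inj₁ w∈ }
    ; active∉seen       = λ ()
    ; active-unique     = []
    ; vertices∈seen′    = here refl ∷ []
    }
  ... | false = record
    { seen⊆seen′        = there
    ; seen′⊆seen∪active = λ { (here refl) → inj₂ (here refl) ; (there w∈) → inj₁ w∈ }
    ; active∉seen       = λ { (here refl) → subst T seen-before ∘ ∈⇒any-== }
    ; active-unique     = [] ∷ []
    ; vertices∈seen′    = here refl ∷ []
    }

module ShiftTreeProperties {n k : ℕ} (G : Graph n) (col : Colouring n k) (u v : Fin n) where
  open ShiftTree G col u v public

  placeChildren-marking : ∀ path ys seen → uncurry (Marking seen) (placeChildren path ys seen)
  placeChildren-marking path []       seen = marking-[]
  placeChildren-marking path (y ∷ ys) seen =
    marking-++ (marking-child path y seen) (placeChildren-marking path ys (y ∷ seen))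

  nextLevel-marking : ∀ cur seen → uncurry (Marking seen) (nextLevel cur seen)
  nextLevel-marking []                     seen = marking-[]
  nextLevel-marking ((path , false) ∷ cur) seen = nextLevel-marking cur seen
  nextLevel-marking ((path , true)  ∷ cur) seen =
    marking-++ (placeChildren-marking path (childVertices path) seen) (nextLevel-marking cur _)

  placeChildren-length : ∀ path ys seen → length (proj₁ (placeChildren path ys seen)) ≡ length ys
  placeChildren-length path []       seen = refl
  placeChildren-length path (y ∷ ys) seen = cong suc (placeChildren-length path ys (y ∷ seen))

  nextLevel-length : ∀ {m} cur seen →
                     (∀ {path} → (path , true) ∈ cur → m ≤ length (childVertices path)) →
                     m * length (activeVertices cur) ≤ length (proj₁ (nextLevel cur seen))
  nextLevel-length {m} [] seen _ = ≤-reflexive (*-zeroʳ m)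
  nextLevel-length ((path , false) ∷ cur) seen branches =
    nextLevel-length cur seen (branches ∘ there)
  nextLevel-length (([] , true) ∷ cur) seen branches =
    nextLevel-length cur seen (branches ∘ there)
  nextLevel-length {m} ((path@(_ ∷ _) , true) ∷ cur) seen branches = begin
    m * suc (length (activeVertices cur))  ≡⟨ *-suc m _ ⟩
    m + m * length (activeVertices cur)    ≤⟨ +-mono-≤ m≤children later-children ⟩
    length children + length later         ≡⟨ length-++ children ⟨
    length (children ++ later)             ∎
    where
    open ≤-Reasoning
    placed = placeChildren path (childVertices path) seen
    children = proj₁ placed
    later = proj₁ (nextLevel cur (proj₂ placed))
    m≤children : m ≤ length children
    m≤children = subst (m ≤_) (sym (placeChildren-length path (childVertices path) seen))
                       (branches (here refl))
    later-children = nextLevel-length cur (proj₂ placed) (branches ∘ there)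

  inactiveCopies≡multiplicity : (w : Fin n) (L : List (Node n)) →
    length (filterᵇ (isInactiveCopyOf w) L) ≡ multiplicity _≟_ w (inactiveVertices L)
  inactiveCopies≡multiplicity w [] = refl
  inactiveCopies≡multiplicity w (([] , true)  ∷ L) = inactiveCopies≡multiplicity w L
  inactiveCopies≡multiplicity w (([] , false) ∷ L) = inactiveCopies≡multiplicity w L
  inactiveCopies≡multiplicity w (((x ∷ _) , true) ∷ L) with x == w
  ... | true  = inactiveCopies≡multiplicity w L
  ... | false = inactiveCopies≡multiplicity w L
  inactiveCopies≡multiplicity w (((x ∷ _) , false) ∷ L) with x == w
  ... | true  = cong suc (inactiveCopies≡multiplicity w L)
  ... | false = inactiveCopies≡multiplicity w L

  seenUpTo : ℕ → List (Fin n)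
  seenUpTo d = proj₂ (proj₂ (grow d))

  grow-suc : ∀ d → grow (suc d) ≡ (nodesUpTo d ++ proj₁ (nextLevel (level d) (seenUpTo d)) ,
                                   nextLevel (level d) (seenUpTo d))
  grow-suc d with grow d
  ... | nodes , cur , seen with nextLevel cur seen
  ... | new , seen′ = refl

  level-suc : ∀ d → level (suc d) ≡ proj₁ (nextLevel (level d) (seenUpTo d))
  level-suc d = cong (proj₁ ∘ proj₂) (grow-suc d)

  nodesUpTo-suc : ∀ d → nodesUpTo (suc d) ≡ nodesUpTo d ++ level (suc d)
  nodesUpTo-suc d = trans (cong proj₁ (grow-suc d)) (cong (nodesUpTo d ++_) (sym (level-suc d)))

  level⊆nodesUpTo : ∀ d → level d ⊆ nodesUpTo d
  level⊆nodesUpTo zero = id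
  level⊆nodesUpTo (suc d) rewrite nodesUpTo-suc d = ∈-++⁺ʳ (nodesUpTo d)

  grow-marking : ∀ d → Marking [] (nodesUpTo d) (seenUpTo d)
  grow-marking zero    = marking-child (u ∷ []) v []
  grow-marking (suc d) =
    subst (λ g → Marking [] (proj₁ g) (proj₂ (proj₂ g))) (sym (grow-suc d))
          (marking-++ (grow-marking d) (nextLevel-marking (level d) (seenUpTo d)))

  nodes≤b*active : ∀ {b nodes seen} → Marking [] nodes seen →
                   (∀ w → length (filterᵇ (isInactiveCopyOf w) nodes) < b) →
                   length nodes ≤ b * length (activeVertices nodes)
  nodes≤b*active {b} {nodes} m few = begin
    length nodes                       ≤⟨ length≤active+inactive (m .vertices∈seen′) ⟩
    length actives + length inactives  ≡⟨ +-comm (length actives) _ ⟩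
    length inactives + length actives  ≤⟨ length+length≤*length _≟_ inactives actives
                                                                inactive⊆active few′ ⟩
    b * length actives                 ∎
    where
    open ≤-Reasoning
    actives = activeVertices nodes
    inactives = inactiveVertices nodes
    inactive⊆active : inactives ⊆ actives
    inactive⊆active =
      [ (λ ()) , id ]′ ∘ m .seen′⊆seen∪active ∘ inactiveVertices⊆ (m .vertices∈seen′)
    few′ : ∀ w → multiplicity _≟_ w inactives < b
    few′ w = subst (_< b) (inactiveCopies≡multiplicity w nodes) (few w)

  active≤n : ∀ {nodes seen} → Marking [] nodes seen → length (activeVertices nodes) ≤ n
  active≤n m =
    ≤-trans (unique⊆⇒length≤ {ys = allFin n} (m .active-unique) (λ {w} _ → ∈-allFin w))
            (≤-reflexive (length-tabulate {n = n} id))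

module _ {n : ℕ} (G : Graph n) where

  Edge : Fin n → Fin n → Set
  Edge a b = T (G a b)

  IsChain : List (Fin n) → Set
  IsChain path@(_ ∷ _ ∷ _) = Linked Edge path
  IsChain _                = ⊥

module Shifting {n k : ℕ} (G : Graph n) (col : Colouring n k)
  (G-sym : ∀ a b → G a b ≡ G b a) (nonEdge : ∀ a b → G a b ≡ false → col a b ≡ nothing) where

  Edge-sym : ∀ {a b} → Edge G a b → Edge G b a
  Edge-sym {a} {b} = subst T (G-sym a b)

  coloured⇒Edge : ∀ {s t c} → col s t ≡ just c → Edge G s t
  coloured⇒Edge {s} {t} col-st with G s t in st∈G
  ... | true  = _
  ... | false with () ← trans (sym (nonEdge s t st∈G)) col-st

  shiftGo-colours-edges : ∀ a b rest {s t c} → Linked (Edge G) (b ∷ rest) →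
                          shiftGo col a b rest s t ≡ just c → Edge G s t
  shiftGo-colours-edges a b [] _ σ-st = coloured⇒Edge σ-st
  shiftGo-colours-edges a b (b′ ∷ rest) {s} {t} (bb′ ∷ chain) σ-st
    with sameEdge b b′ s t in same
  ... | false = shiftGo-colours-edges b b′ rest chain σ-st
  ... | true with sameEdge⇒ {a = b} {b′} {s} {t} (from T-≡ same)
  ...   | inj₁ (refl , refl) = bb′
  ...   | inj₂ (refl , refl) = Edge-sym bb′

  shiftRev-colours-edges : ∀ {path s t c} → IsChain G path →
                           shiftRev col path s t ≡ just c → Edge G s t
  shiftRev-colours-edges {x ∷ p ∷ rest} {s} {t} (_ ∷ chain) σ-st with sameEdge x p s t
  ... | false = shiftGo-colours-edges x p rest chain σ-st

  shiftRev-uncolours : ∀ x p rest → shiftRev col (x ∷ p ∷ rest) p x ≡ nothing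
  shiftRev-uncolours x p rest with sameEdge x p p x | sameEdge-flip x p
  ... | true | _ = refl

module Growth {n Δ C : ℕ} (G : Graph n) (col : Colouring n (Δ + C)) (u v : Fin n)
  (G-sym : ∀ a b → G a b ≡ G b a) (nonEdge : ∀ a b → G a b ≡ false → col a b ≡ nothing)
  (maxDegree : MaxDegreeAtMost G Δ) (uv∈G : G u v ≡ true) where

  open ShiftTreeProperties G col u v
  open Shifting G col G-sym nonEdge

  neighbours : Fin n → List (Fin n)
  neighbours w = filterᵇ (G w) (allFin n)

  -- A colour missing at p (after the shift) is on an edge at p other than the now uncoloured
  -- (p,x); a colour free at p is, as the node is not useful, on an edge (x,y) to a child y.
  branching : ∀ path → IsChain G path → ¬ UsefulNode (path , true) →
              suc C ≤ length (childVertices path)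
  branching path@(x ∷ p ∷ rest) chain@(xp ∷ _) notUseful =
    +-cancelˡ-< Δ C (length children) (begin-strict
      Δ + C                                     ≡⟨ length-tabulate id ⟨
      length (allFin (Δ + C))                   ≤⟨ unique⊆⇒length≤ (allFin⁺ _) colours-covered ⟩
      length (usedAtP ++ mapMaybe (σ x) children)
                                                ≡⟨ length-++ usedAtP ⟩
      length usedAtP + length (mapMaybe (σ x) children)
                                                ≤⟨ +-monoʳ-≤ _ (length-mapMaybe (σ x) children) ⟩
      length usedAtP + length children          <⟨ +-monoˡ-< _ usedAtP<degree ⟩
      degree G p + length children              ≤⟨ +-monoˡ-≤ _ (maxDegree p) ⟩
      Δ + length children                       ∎)
    where
    open ≤-Reasoning
    σ = shiftRev col path
    children = childVertices path
    usedAtP = mapMaybe (σ p) (neighbours p)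
    usedAtP<degree : length usedAtP < degree G p
    usedAtP<degree = length-mapMaybe-< (∈-filter⁺ (T? ∘ G p) (∈-allFin x) (Edge-sym xp))
                                       (shiftRev-uncolours x p rest)
    colours-covered : allFin (Δ + C) ⊆ usedAtP ++ mapMaybe (σ x) children
    colours-covered {c} _ with T? (available σ p c)
    ... | no unavailable-p =
      let z , σpz≡c = unavailable⇒coloured σ p c unavailable-p
          neighbour = ∈-filter⁺ (T? ∘ G p) (∈-allFin z) (shiftRev-colours-edges chain σpz≡c)
      in ∈-++⁺ˡ (∈-mapMaybe⁺ neighbour σpz≡c)
    ... | yes available-p =
      let z , σxz≡c = unavailable⇒coloured σ x c λ available-x →
                        notUseful (c , from T-∧ (available-p , available-x))
          child : T (G x z ∧ colourIn (σ x z) (available σ p))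
          child = subst (λ m → T (G x z ∧ colourIn m (available σ p))) (sym σxz≡c)
                        (from T-∧ (shiftRev-colours-edges chain σxz≡c , available-p))
      in ∈-++⁺ʳ usedAtP (∈-mapMaybe⁺ (∈-filter⁺ (T? ∘ _) (∈-allFin z) child) σxz≡c)

  childVertices-extend : ∀ path → IsChain G path →
                         All (λ y → IsChain G (y ∷ path)) (childVertices path)
  childVertices-extend path@(x ∷ _ ∷ _) chain = All.tabulate λ y∈children →
    Edge-sym (proj₁ (to T-∧ (proj₂ (∈-filter⁻ (T? ∘ _) {xs = allFin n} y∈children)))) ∷ chain

  placeChildren-chains : ∀ path ys seen → All (λ y → IsChain G (y ∷ path)) ys →
                         All (IsChain G ∘ proj₁) (proj₁ (placeChildren path ys seen))
  placeChildren-chains path []       seen []             = []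
  placeChildren-chains path (y ∷ ys) seen (chain ∷ rest) =
    chain ∷ placeChildren-chains path ys (y ∷ seen) rest

  nextLevel-chains : ∀ cur seen → All (IsChain G ∘ proj₁) cur →
                     All (IsChain G ∘ proj₁) (proj₁ (nextLevel cur seen))
  nextLevel-chains []                     seen []               = []
  nextLevel-chains ((path , false) ∷ cur) seen (_ ∷ chains)     = nextLevel-chains cur seen chains
  nextLevel-chains ((path , true)  ∷ cur) seen (chain ∷ chains) =
    All.++⁺ (placeChildren-chains path (childVertices path) seen (childVertices-extend path chain))
            (nextLevel-chains cur _ chains)

  level-chains : ∀ d → All (IsChain G ∘ proj₁) (level d)
  level-chains zero    = (Edge-sym (from T-≡ uv∈G) ∷ [-]) ∷ []
  level-chains (suc d) = subst (All (IsChain G ∘ proj₁)) (sym (level-suc d))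
                               (nextLevel-chains (level d) (seenUpTo d) (level-chains d))

  K : ℕ
  K = suc C

  activeUpTo activeAt sizeUpTo : ℕ → ℕ
  activeUpTo d = length (activeVertices (nodesUpTo d))
  activeAt   d = length (activeVertices (level d))
  sizeUpTo   d = length (nodesUpTo d)

  sizeUpTo-suc : ∀ d → sizeUpTo (suc d) ≡ sizeUpTo d + length (level (suc d))
  sizeUpTo-suc d = trans (cong length (nodesUpTo-suc d)) (length-++ (nodesUpTo d))

  activeUpTo-suc : ∀ d → activeUpTo (suc d) ≡ activeUpTo d + activeAt (suc d)
  activeUpTo-suc d = begin
    length (activeVertices (nodesUpTo (suc d)))
      ≡⟨ cong (length ∘ activeVertices) (nodesUpTo-suc d) ⟩
    length (activeVertices (nodesUpTo d ++ level (suc d)))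
      ≡⟨ cong length (mapMaybe-++ activeVertex (nodesUpTo d) (level (suc d))) ⟩
    length (activeVertices (nodesUpTo d) ++ activeVertices (level (suc d)))
      ≡⟨ length-++ (activeVertices (nodesUpTo d)) ⟩
    activeUpTo d + activeAt (suc d) ∎
    where open ≡-Reasoning

  level-suc-size : ∀ d → ¬ HasUseful (nodesUpTo d) → K * activeAt d ≤ length (level (suc d))
  level-suc-size d noUseful =
    subst (K * activeAt d ≤_) (cong length (sym (level-suc d)))
          (nextLevel-length (level d) (seenUpTo d) λ node∈ →
            branching _ (All.lookup (level-chains d) node∈)
                        (λ useful → noUseful (_ , level⊆nodesUpTo d node∈ , useful)))

  -- Each active node of levels ≤ d has at least K children; the 1 is the root.
  nodes-lower-bound : ∀ d → (∀ j → j ≤ d → ¬ HasUseful (nodesUpTo j)) →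
                      1 + K * activeUpTo d ≤ sizeUpTo (suc d)
  nodes-lower-bound zero noUseful = begin
    1 + K * activeAt 0    ≤⟨ +-monoʳ-≤ 1 (level-suc-size 0 (noUseful 0 ≤-refl)) ⟩
    1 + length (level 1)  ≡⟨ sizeUpTo-suc 0 ⟨
    sizeUpTo 1            ∎
    where open ≤-Reasoning
  nodes-lower-bound (suc d) noUseful = begin
    1 + K * activeUpTo (suc d)                   ≡⟨ cong (λ a → 1 + K * a) (activeUpTo-suc d) ⟩
    1 + K * (activeUpTo d + activeAt (suc d))    ≡⟨ cong (1 +_) (*-distribˡ-+ K (activeUpTo d) _) ⟩
    1 + K * activeUpTo d + K * activeAt (suc d)  ≤⟨ +-mono-≤ earlier-levels last-level ⟩
    sizeUpTo (suc d) + length (level (2 + d))    ≡⟨ sizeUpTo-suc (suc d) ⟨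
    sizeUpTo (2 + d)                             ∎
    where
    open ≤-Reasoning
    earlier-levels = nodes-lower-bound d (λ j j≤d → noUseful j (m≤n⇒m≤1+n j≤d))
    last-level = level-suc-size (suc d) (noUseful (suc d) ≤-refl)

  active-growth : ∀ {b} d → (∀ j → j ≤ d → ¬ HasUseful (nodesUpTo j)) →
                  ¬ HasBInactive b (nodesUpTo (suc d)) → K * activeUpTo d ≤ b * activeUpTo (suc d)
  active-growth {b} d noUseful noBInactive = begin
    K * activeUpTo d        <⟨ n<1+n _ ⟩
    1 + K * activeUpTo d    ≤⟨ nodes-lower-bound d noUseful ⟩
    sizeUpTo (suc d)        ≤⟨ nodes≤b*active (grow-marking (suc d)) (λ w → ≰⇒> (noBInactive ∘ (w ,_))) ⟩
    b * activeUpTo (suc d)  ∎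
    where open ≤-Reasoning

  never-stopping-bound : ∀ {b} D → (∀ j → j ≤ D → ¬ StopsAt b j) → K ^ D ≤ n * b ^ D
  never-stopping-bound {b} D noStop = begin
    K ^ D                 ≤⟨ geometric-growth activeUpTo D ≤-refl growth ⟩
    b ^ D * activeUpTo D  ≤⟨ *-monoʳ-≤ (b ^ D) (active≤n (grow-marking D)) ⟩
    b ^ D * n             ≡⟨ *-comm (b ^ D) n ⟩
    n * b ^ D             ∎
    where
    open ≤-Reasoning
    growth : ∀ d → d < D → K * activeUpTo d ≤ b * activeUpTo (suc d)
    growth d d<D = active-growth d (λ j j≤d → noStop j (≤-trans j≤d (<⇒≤ d<D)) ∘ inj₁)
                                   (noStop (suc d) d<D ∘ inj₂)

mainTheorem11 : (n Δ C : ℕ) (G : Graph n) (col : Colouring n (Δ + C)) (u v : Fin n) (b : ℕ)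
    → SimpleGraph G → MaxDegreeAtMost G Δ → ProperlyColouredExcept G col u v
    → 1 ≤ b → b ≤ C
    → (H : ℕ) → IsFloorLog C b n H
    → ShiftTree.DepthAtMost G col u v b (suc H)
mainTheorem11 n Δ C G col u v b (_ , G-sym) maxDegree (uv∈G , _ , _ , nonEdge , _) _ _
              H (_ , n*b^H+1<K^H+1) d notStoppedBefore-d _ =
  ≮⇒≥ λ H+1<d → <⇒≱ n*b^H+1<K^H+1
    (never-stopping-bound (suc H) λ j j≤H+1 → notStoppedBefore-d j (≤-<-trans j≤H+1 H+1<d))
  where open Growth G col u v G-sym nonEdge maxDegree uv∈G
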